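{- Let $n\ge 1$, let $S\subseteq \{1,2,\ldots,\lfloor n/2\rfloor\}$, and let $G=C_n(S)$ be the corresponding circulant graph. Then $G$ is chordal if and only if there exists an integer $d\geq 1$ such that $n=dm$ for some integer $m$ and $G=C_{n}(\{d,2d,\ldots,\lfloor\frac{m}{2}\rfloor d\})$.
   Context: For $S\subseteq T:=\{1,2,\ldots,\lfloor n/2\rfloor\}$, the circulant graph $C_n(S)$ is the simple graph with vertex set $\mathbb{Z}_n=\{0,\ldots,n-1\}$ and edge set $\{\{i,j\} : |j-i|_n\in S\}$, where $|k|_n=\min\{|k|,n-|k|\}$ (computed for the integer representatives $i,j\in\{0,\ldots,n-1\}$). A chord of a cycle $\mathcal{C}$ in a graph $G$ is an edge of $G$ not in $\mathcal{C}$ joining two vertices of $\mathcal{C}$; $G$ is chordal if every cycle of length at least $4$ has a chord. -}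

module Defs where

open import Data.Nat using (ℕ; zero; suc; _+_; _*_; _∸_; _≤_; _<_; _⊓_; ∣_-_∣; _≡ᵇ_; _/_)
open import Data.Fin using (Fin; toℕ)
open import Data.Bool using (Bool; true; false; if_then_else_)
open import Data.Product using (Σ; ∃; _×_; _,_)
open import Relation.Binary.PropositionalEquality using (_≡_; _≢_)
open import Relation.Nullary using (¬_)

circDist : (n : ℕ) → Fin n → Fin n → ℕ
circDist n i j = ∣ toℕ i - toℕ j ∣ ⊓ (n ∸ ∣ toℕ i - toℕ j ∣)

AdjP : (n : ℕ) → (ℕ → Set) → Fin n → Fin n → Set
AdjP n P i j = P (circDist n i j)

Mem : (ℕ → Bool) → ℕ → Set
Mem S k = S k ≡ true

ConnSet : ℕ → (ℕ → Bool) → Set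
ConnSet n S = ∀ k → Mem S k → (1 ≤ k) × (k ≤ n / 2)

Adj : (n : ℕ) → (ℕ → Bool) → Fin n → Fin n → Set
Adj n S = AdjP n (Mem S)

next : ℕ → ℕ → ℕ
next k i = if suc i ≡ᵇ k then 0 else suc i

IsCycle : (n : ℕ) → (ℕ → Bool) → (k : ℕ) → (ℕ → Fin n) → Set
IsCycle n S k f =
  (3 ≤ k) ×
  (∀ i j → i < k → j < k → f i ≡ f j → i ≡ j) ×
  (∀ i → i < k → Adj n S (f i) (f (next k i)))

HasChord : (n : ℕ) → (ℕ → Bool) → (k : ℕ) → (ℕ → Fin n) → Set
HasChord n S k f =
  Σ ℕ λ i → Σ ℕ λ j → (i < k) × (j < k) × Adj n S (f i) (f j)
    × (next k i ≢ j) × (next k j ≢ i)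

Chordal : (n : ℕ) → (ℕ → Bool) → Set
Chordal n S = ∀ k (f : ℕ → Fin n) → 4 ≤ k → IsCycle n S k f → HasChord n S k f

Multiples : ℕ → ℕ → ℕ → Set
Multiples d m x = Σ ℕ λ l → (1 ≤ l) × (l ≤ m / 2) × (x ≡ l * d)

SameGraph : (n : ℕ) → (ℕ → Set) → (ℕ → Set) → Set
SameGraph n P Q = ∀ i j → (AdjP n P i j → AdjP n Q i j) × (AdjP n Q i j → AdjP n P i j)

module Submission where

-- Vertices are handled through labels x ∈ ℕ read modulo n: vertices with
-- labels x ≥ y are adjacent exactly when x - y is a connection length, i.e.
-- its residue lies at a circular distance belonging to S.
--
-- (⇐) In C_n({d, …, ⌊m/2⌋d}) distinct vertices are adjacent exactly when their
--     labels agree modulo d; adjacency is transitive, so the first and third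
--     vertex of any cycle are joined by a chord.
-- (⇒) Let d be the least element of S (if S is empty, take d = n and m = 1).
--     (1) Every multiple of d is a connection length or ≡ 0, since the first
--         gap among the multiples of d produces a long chordless cycle.
--     (2) d ∣ n, for otherwise (⌊n/d⌋ + 1)d would be a connection length with
--         nonzero residue below d.
--     (3) Every element of S is a multiple of d: for a least counterexample b,
--         4-cycles 0, d, b + (l+1)d, b show that all b + ld are connection
--         lengths, and one of them is ≡ b mod d, a residue below d.
--     Hence S = {d, …, ⌊m/2⌋d} with m = n/d.

open import Defs
open import Data.Nat
open import Data.Nat.Properties
open import Data.Nat.DivMod
open import Data.Nat.Divisibility
open import Data.Nat.Induction using (<-rec)
open import Data.Nat.Tactic.RingSolver using (solve-∀)
open import Data.Fin using (Fin; toℕ; fromℕ<)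
open import Data.Fin.Properties using (toℕ-fromℕ<; toℕ-injective; toℕ<n)
open import Data.Bool using (Bool; true; false)
import Data.Bool.Properties as Bool
open import Data.Unit using (tt)
open import Data.Product
open import Data.Sum
open import Data.Empty
open import Relation.Nullary
open import Relation.Nullary.Decidable using (_⊎-dec_; _×-dec_; ¬?; decidable-stable)
open import Relation.Binary.PropositionalEquality
open import Relation.Binary.Definitions using (tri<; tri≈; tri>)
open import Function using (_∘_)
open import Function.Bundles using (_⇔_; mk⇔)

-- x ≤ ⌊z/2⌋ exactly when 2x ≤ z; this translates the bounds ⌊n/2⌋ of ConnSet
-- and ⌊m/2⌋ of Multiples into additive form.
≤half⇒double≤ : ∀ x z → x ≤ z / 2 → x + x ≤ z
≤half⇒double≤ x z x≤ = ≤-trans (+-mono-≤ x≤ x≤) (subst (_≤ z) 2*half (m/n*n≤m z 2))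
  where
    2*half : z / 2 * 2 ≡ z / 2 + z / 2
    2*half = trans (*-comm (z / 2) 2) (cong (z / 2 +_) (+-identityʳ (z / 2)))

double≤⇒≤half : ∀ x z → x + x ≤ z → x ≤ z / 2
double≤⇒≤half x z x+x≤ = subst (_≤ z / 2) (m*n/n≡m x 2) (/-monoˡ-≤ 2 (subst (_≤ z) x*2 x+x≤))
  where
    x*2 : x + x ≡ x * 2
    x*2 = sym (trans (*-comm x 2) (cong (x +_) (+-identityʳ x)))

m+n≤o⇒n≤o∸m : ∀ m {n o} → m + n ≤ o → n ≤ o ∸ m
m+n≤o⇒n≤o∸m m {n} {o} m+n≤o = m+n≤o⇒m≤o∸n n (subst (_≤ o) (+-comm m n) m+n≤o)

%-≡⇒∣∸ : ∀ e .{{_ : NonZero e}} x y → y ≤ x → x % e ≡ y % e → e ∣ x ∸ y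
%-≡⇒∣∸ e x y y≤x x≡y = divides (x / e ∸ y / e) (begin
    x ∸ y                                      ≡⟨ cong₂ _∸_ (m≡m%n+[m/n]*n x e) (m≡m%n+[m/n]*n y e) ⟩
    (x % e + x / e * e) ∸ (y % e + y / e * e)  ≡⟨ cong (λ z → (z + x / e * e) ∸ (y % e + y / e * e)) x≡y ⟩
    (y % e + x / e * e) ∸ (y % e + y / e * e)  ≡⟨ [m+n]∸[m+o]≡n∸o (y % e) (x / e * e) (y / e * e) ⟩
    x / e * e ∸ y / e * e                      ≡⟨ sym (*-distribʳ-∸ e (x / e) (y / e)) ⟩
    (x / e ∸ y / e) * e                        ∎)
  where open ≡-Reasoning

multiple≤half : ∀ l d m .{{_ : NonZero d}} → l * d + l * d ≤ m * d → l ≤ m / 2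
multiple≤half l d m le =
  double≤⇒≤half l m (*-cancelʳ-≤ (l + l) m d (subst (_≤ m * d) (sym (*-distribʳ-+ d l l)) le))

half⇒multiple≤ : ∀ l d m → l ≤ m / 2 → l * d + l * d ≤ m * d
half⇒multiple≤ l d m l≤ = subst (_≤ m * d) (*-distribʳ-+ d l l) (*-monoˡ-≤ d (≤half⇒double≤ l m l≤))

leastUpTo : {Q : ℕ → Set} → (∀ x → Dec (Q x)) → ∀ N →
  (∀ i → i ≤ N → ¬ Q i) ⊎ (Σ ℕ λ k → k ≤ N × Q k × (∀ i → i < k → ¬ Q i))
leastUpTo Q? zero with Q? 0
... | yes q = inj₂ (0 , z≤n , q , λ _ ())
... | no ¬q = inj₁ λ { .zero z≤n → ¬q }
leastUpTo Q? (suc N) with leastUpTo Q? N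
... | inj₂ (k , k≤N , q , below) = inj₂ (k , m≤n⇒m≤1+n k≤N , q , below)
... | inj₁ none with Q? (suc N)
...   | yes q = inj₂ (suc N , ≤-refl , q , λ i i<1+N → none i (s≤s⁻¹ i<1+N))
...   | no ¬q = inj₁ noneUpTo
  where
    noneUpTo : ∀ i → i ≤ suc N → ¬ _
    noneUpTo i i≤1+N with m≤n⇒m<n∨m≡n i≤1+N
    ... | inj₁ i<1+N = none i (s≤s⁻¹ i<1+N)
    ... | inj₂ refl = ¬q

least : {Q : ℕ → Set} → (∀ x → Dec (Q x)) → ∀ N → Q N →
  Σ ℕ λ k → k ≤ N × Q k × (∀ i → i < k → ¬ Q i)
least Q? N q with leastUpTo Q? N
... | inj₁ none = ⊥-elim (none N ≤-refl q)
... | inj₂ found = found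

increasing⇒monotone : (v : ℕ → ℕ) (N : ℕ) → (∀ i → i < N → v i < v (suc i)) →
  ∀ {a b} → a ≤ b → b ≤ N → v a ≤ v b
increasing⇒monotone v N step {a} {zero} z≤n _ = ≤-refl
increasing⇒monotone v N step {a} {suc b} a≤1+b 1+b≤N with m≤n⇒m<n∨m≡n a≤1+b
... | inj₂ refl = ≤-refl
... | inj₁ a<1+b = ≤-trans (increasing⇒monotone v N step (s≤s⁻¹ a<1+b) (<⇒≤ 1+b≤N))
                           (<⇒≤ (step b 1+b≤N))

module Cycles (n : ℕ) (S : ℕ → Bool) (loopless : ¬ Mem S 0) where

  adj-sym : ∀ i j → Adj n S i j → Adj n S j i
  adj-sym i j = subst (λ u → Mem S (u ⊓ (n ∸ u))) (∣-∣-comm (toℕ i) (toℕ j))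

  adj-irrefl : ∀ i → ¬ Adj n S i i
  adj-irrefl i = loopless ∘ subst (λ u → Mem S (u ⊓ (n ∸ u))) (∣n-n∣≡0 (toℕ i))

  next-inner : ∀ {K i} → suc i < K → next K i ≡ suc i
  next-inner {K} {i} 1+i<K with suc i ≡ᵇ K | ≡ᵇ⇒≡ (suc i) K
  ... | false | _ = refl
  ... | true | 1+i≡K = ⊥-elim (<-irrefl (1+i≡K tt) 1+i<K)

  next-last : ∀ i → next (suc i) i ≡ 0
  next-last i with suc i ≡ᵇ suc i | ≡⇒≡ᵇ (suc i) (suc i) refl
  ... | true | _ = refl

  ordered⇒injective : ∀ L (f : ℕ → Fin n) → (∀ a b → a < b → b ≤ L → f a ≢ f b) →
    ∀ i j → i < suc L → j < suc L → f i ≡ f j → i ≡ j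
  ordered⇒injective L f distinct i j i≤L j≤L fi≡fj with <-cmp i j
  ... | tri< i<j _ _ = ⊥-elim (distinct i j i<j (s≤s⁻¹ j≤L) fi≡fj)
  ... | tri≈ _ i≡j _ = i≡j
  ... | tri> _ _ j<i = ⊥-elim (distinct j i j<i (s≤s⁻¹ i≤L) (sym fi≡fj))

  mkCycle : ∀ L (f : ℕ → Fin n) → 2 ≤ L → (∀ a b → a < b → b ≤ L → f a ≢ f b) →
    (∀ i → i < L → Adj n S (f i) (f (suc i))) → Adj n S (f L) (f 0) → IsCycle n S (suc L) f
  mkCycle L f 2≤L distinct path closing =
    s≤s 2≤L , ordered⇒injective L f distinct , edge
    where
      edge : ∀ i → i < suc L → Adj n S (f i) (f (next (suc L) i))
      edge i i≤L with m≤n⇒m<n∨m≡n (s≤s⁻¹ i≤L)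
      ... | inj₁ i<L rewrite next-inner {suc L} (s≤s i<L) = path i i<L
      ... | inj₂ refl rewrite next-last i = closing

  -- A chord of a cycle of length L + 1, listed with its smaller end first:
  -- it skips a position, and it is not the closing edge from f L to f 0.
  OrientedChord : ∀ L (f : ℕ → Fin n) → Set
  OrientedChord L f = Σ ℕ λ a → Σ ℕ λ b →
    suc a < b × b ≤ L × Adj n S (f a) (f b) × (0 < a ⊎ b < L)

  orientOrdered : ∀ L (f : ℕ → Fin n) a b → a < b → b ≤ L → Adj n S (f a) (f b) →
    next (suc L) a ≢ b → next (suc L) b ≢ a → OrientedChord L f
  orientOrdered L f a b a<b b≤L a~b a↛b b↛a = a , b , skips , b≤L , a~b , notClosing a refl
    where
      skips : suc a < b
      skips = ≤∧≢⇒< a<b (λ 1+a≡b → a↛b (trans (next-inner (s≤s (≤-trans a<b b≤L))) 1+a≡b))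
      notClosing : ∀ a′ → a′ ≡ a → 0 < a′ ⊎ b < L
      notClosing (suc _) _ = inj₁ (s≤s z≤n)
      notClosing zero 0≡a = inj₂ (≤∧≢⇒< b≤L λ { refl → b↛a (trans (next-last b) 0≡a) })

  orient : ∀ L (f : ℕ → Fin n) → HasChord n S (suc L) f → OrientedChord L f
  orient L f (i , j , i≤L , j≤L , i~j , i↛j , j↛i) with <-cmp i j
  ... | tri< i<j _ _ = orientOrdered L f i j i<j (s≤s⁻¹ j≤L) i~j i↛j j↛i
  ... | tri≈ _ refl _ = ⊥-elim (adj-irrefl (f i) i~j)
  ... | tri> _ _ j<i = orientOrdered L f j i j<i (s≤s⁻¹ i≤L) (adj-sym (f i) (f j) i~j) j↛i i↛j

  adj⇒≢ : ∀ i j → Adj n S i j → i ≢ j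
  adj⇒≢ i .i i~i refl = adj-irrefl i i~i

  square-diagonal : Chordal n S → ∀ x₀ x₁ x₂ x₃ →
    Adj n S x₀ x₁ → Adj n S x₁ x₂ → Adj n S x₂ x₃ → Adj n S x₃ x₀ → x₀ ≢ x₂ → x₁ ≢ x₃ →
    Adj n S x₀ x₂ ⊎ Adj n S x₁ x₃
  square-diagonal chordal x₀ x₁ x₂ x₃ x₀~x₁ x₁~x₂ x₂~x₃ x₃~x₀ x₀≢x₂ x₁≢x₃ =
    diagonal (orient 3 f (chordal 4 f ≤-refl (mkCycle 3 f (s≤s (s≤s z≤n)) distinct path x₃~x₀)))
    where
      f : ℕ → Fin n
      f 0 = x₀
      f 1 = x₁
      f 2 = x₂
      f _ = x₃

      distinct : ∀ a b → a < b → b ≤ 3 → f a ≢ f b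
      distinct 0 1 _ _ = adj⇒≢ x₀ x₁ x₀~x₁
      distinct 0 2 _ _ = x₀≢x₂
      distinct 0 3 _ _ = adj⇒≢ x₀ x₃ (adj-sym x₃ x₀ x₃~x₀)
      distinct 1 2 _ _ = adj⇒≢ x₁ x₂ x₁~x₂
      distinct 1 3 _ _ = x₁≢x₃
      distinct 2 3 _ _ = adj⇒≢ x₂ x₃ x₂~x₃
      distinct _ (suc (suc (suc (suc _)))) _ (s≤s (s≤s (s≤s ())))
      distinct _ 0 () _
      distinct (suc _) 1 (s≤s ()) _
      distinct (suc (suc _)) 2 (s≤s (s≤s ())) _
      distinct (suc (suc (suc _))) 3 (s≤s (s≤s (s≤s ()))) _

      path : ∀ i → i < 3 → Adj n S (f i) (f (suc i))
      path 0 _ = x₀~x₁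
      path 1 _ = x₁~x₂
      path 2 _ = x₂~x₃
      path (suc (suc (suc _))) (s≤s (s≤s (s≤s ())))

      diagonal : OrientedChord 3 f → Adj n S x₀ x₂ ⊎ Adj n S x₁ x₃
      diagonal (0 , 2 , _ , _ , x₀~x₂ , _) = inj₁ x₀~x₂
      diagonal (1 , 3 , _ , _ , x₁~x₃ , _) = inj₂ x₁~x₃
      diagonal (0 , 3 , _ , _ , _ , inj₁ ())
      diagonal (0 , 3 , _ , _ , _ , inj₂ (s≤s (s≤s (s≤s ()))))
      diagonal (_ , suc (suc (suc (suc _))) , _ , s≤s (s≤s (s≤s ())) , _)
      diagonal (_ , 0 , () , _)
      diagonal (_ , 1 , s≤s () , _)
      diagonal (suc _ , 2 , s≤s (s≤s ()) , _)
      diagonal (suc (suc _) , 3 , s≤s (s≤s (s≤s ())) , _)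

module Circulant (n : ℕ) {{n≢0 : NonZero n}} (S : ℕ → Bool) (loopless : ¬ Mem S 0) where

  open Cycles n S loopless public

  vertex : ℕ → Fin n
  vertex x = fromℕ< (m%n<n x n)

  toℕ-vertex : ∀ x → toℕ (vertex x) ≡ x % n
  toℕ-vertex x = toℕ-fromℕ< (m%n<n x n)

  vertex-cong : ∀ {x y} → x % n ≡ y % n → vertex x ≡ vertex y
  vertex-cong {x} {y} x≡y = toℕ-injective (trans (toℕ-vertex x) (trans x≡y (sym (toℕ-vertex y))))

  vertex-≡⇒∣ : ∀ {x y} → y ≤ x → vertex x ≡ vertex y → n ∣ x ∸ y
  vertex-≡⇒∣ {x} {y} y≤x x≡y =
    %-≡⇒∣∸ n x y y≤x (trans (sym (toℕ-vertex x)) (trans (cong toℕ x≡y) (toℕ-vertex y)))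

  dist : ℕ → ℕ
  dist u = u ⊓ (n ∸ u)

  dist-flip : ∀ {u} → u ≤ n → dist (n ∸ u) ≡ dist u
  dist-flip {u} u≤n = trans (cong ((n ∸ u) ⊓_) (m∸[m∸n]≡n u≤n)) (⊓-comm (n ∸ u) u)

  Edge : ℕ → Set
  Edge x = Mem S (dist (x % n))

  edge? : ∀ x → Dec (Edge x)
  edge? x = S (dist (x % n)) Bool.≟ true

  edge-mod : ∀ {x y} → x % n ≡ y % n → Edge x → Edge y
  edge-mod x≡y = subst (Mem S ∘ dist) x≡y

  half<n : ∀ x → x + x ≤ n → x < n
  half<n zero _ = >-nonZero⁻¹ n
  half<n (suc x) x+x≤n = <-≤-trans (m<m+n (suc x) z<s) x+x≤n

  half⇒∤ : ∀ {x} → 0 < x → x + x ≤ n → ¬ n ∣ x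
  half⇒∤ {x} 0<x x+x≤n n∣x = <⇒≱ (half<n x x+x≤n) (∣⇒≤ {{>-nonZero 0<x}} n∣x)

  dist-small : ∀ {x} → x + x ≤ n → dist (x % n) ≡ x
  dist-small {x} x+x≤n = trans (cong dist (m<n⇒m%n≡m (half<n x x+x≤n))) (m≤n⇒m⊓n≡m (m+n≤o⇒m≤o∸n x x+x≤n))

  edge⇒mem : ∀ {x} → x + x ≤ n → Edge x → Mem S x
  edge⇒mem x+x≤n = subst (Mem S) (dist-small x+x≤n)

  mem⇒edge : ∀ {x} → x + x ≤ n → Mem S x → Edge x
  mem⇒edge x+x≤n = subst (Mem S) (sym (dist-small x+x≤n))

  residue-sum : ∀ x y → y ≤ x → ((x ∸ y) % n + y % n) % n ≡ x % n
  residue-sum x y y≤x = trans (sym (%-distribˡ-+ (x ∸ y) y n)) (cong (_% n) (m∸n+n≡m y≤x))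

  residue-difference : ∀ x y → y ≤ x →
    ∣ x % n - y % n ∣ ≡ (x ∸ y) % n ⊎ ∣ x % n - y % n ∣ ≡ n ∸ (x ∸ y) % n
  residue-difference x y y≤x with (x ∸ y) % n + y % n <? n
  ... | yes no-wrap = inj₁ (begin
      ∣ x % n - b ∣      ≡⟨ cong (λ a → ∣ a - b ∣) a≡u+b ⟨
      ∣ u + b - b ∣      ≡⟨ ∣-∣-comm (u + b) b ⟩
      ∣ b - u + b ∣      ≡⟨ cong (λ t → ∣ b - t ∣) (+-comm u b) ⟩
      ∣ b - b + u ∣      ≡⟨ ∣m-m+n∣≡n b u ⟩
      u                  ∎)
    where
      open ≡-Reasoning
      u b : ℕ
      u = (x ∸ y) % n
      b = y % n
      a≡u+b : u + b ≡ x % n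
      a≡u+b = trans (sym (m<n⇒m%n≡m no-wrap)) (residue-sum x y y≤x)
  ... | no wrap = inj₂ (begin
      ∣ a - b ∣              ≡⟨ ∣m+n-m+o∣≡∣n-o∣ n a b ⟨
      ∣ n + a - n + b ∣      ≡⟨ cong₂ (λ s t → ∣ s - t ∣) (trans (+-comm n a) a+n≡u+b) (+-comm n b) ⟩
      ∣ u + b - b + n ∣      ≡⟨ cong (λ s → ∣ s - b + n ∣) (+-comm u b) ⟩
      ∣ b + u - b + n ∣      ≡⟨ ∣m+n-m+o∣≡∣n-o∣ b u n ⟩
      ∣ u - n ∣              ≡⟨ m≤n⇒∣m-n∣≡n∸m (<⇒≤ (m%n<n (x ∸ y) n)) ⟩
      n ∸ u                  ∎)
    where
      open ≡-Reasoning
      a b u : ℕ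
      a = x % n
      b = y % n
      u = (x ∸ y) % n
      n≤u+b : n ≤ u + b
      n≤u+b = ≮⇒≥ wrap
      u+b-n<n : u + b ∸ n < n
      u+b-n<n = m<n+o⇒m∸n<o (u + b) n (+-mono-< (m%n<n (x ∸ y) n) (m%n<n y n))
      a+n≡u+b : a + n ≡ u + b
      a+n≡u+b = begin
        a + n                  ≡⟨ cong (_+ n) (residue-sum x y y≤x) ⟨
        (u + b) % n + n        ≡⟨ cong (_+ n) (m≤n⇒[n∸m]%m≡n%m n≤u+b) ⟨
        (u + b ∸ n) % n + n    ≡⟨ cong (_+ n) (m<n⇒m%n≡m u+b-n<n) ⟩
        u + b ∸ n + n          ≡⟨ m∸n+n≡m n≤u+b ⟩
        u + b                  ∎

  circDist-vertex : ∀ {x y} → y ≤ x → circDist n (vertex x) (vertex y) ≡ dist ((x ∸ y) % n)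
  circDist-vertex {x} {y} y≤x
    rewrite toℕ-vertex x | toℕ-vertex y with residue-difference x y y≤x
  ... | inj₁ same = cong dist same
  ... | inj₂ flipped = trans (cong dist flipped) (dist-flip (<⇒≤ (m%n<n (x ∸ y) n)))

  edge⇒adj : ∀ {x y} → y ≤ x → Edge (x ∸ y) → Adj n S (vertex x) (vertex y)
  edge⇒adj y≤x = subst (Mem S) (sym (circDist-vertex y≤x))

  adj⇒edge : ∀ {x y} → y ≤ x → Adj n S (vertex x) (vertex y) → Edge (x ∸ y)
  adj⇒edge y≤x = subst (Mem S) (circDist-vertex y≤x)

  edge-neg : ∀ {x y} → n ∣ x + y → Edge x → Edge y
  edge-neg {x} {y} n∣x+y edge = adj⇒edge z≤n (adj-sym (vertex 0) (vertex y) 0~y)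
    where
      x+y≡0 : (x + y) % n ≡ 0 % n
      x+y≡0 = trans (n∣m⇒m%n≡0 (x + y) n n∣x+y) (sym (m<n⇒m%n≡m (>-nonZero⁻¹ n)))
      0~y : Adj n S (vertex 0) (vertex y)
      0~y = subst (λ v → Adj n S v (vertex y)) (vertex-cong x+y≡0)
              (edge⇒adj (m≤n+m y x) (subst Edge (sym (m+n∸n≡m x y)) edge))

  -- A gap in the multiples of d yields a chordless cycle.  Suppose δd is a
  -- connection length for 1 ≤ δ ≤ e, is not one for e < δ < j, is one again
  -- for δ = j, and none of d, 2d, …, jd is ≡ 0.  Writing j = 2 + r + qe with
  -- r < e, the labels 0, 1, 1 + e, 1 + 2e, …, 1 + qe, j (times d) form a cycle
  -- with steps 1, e, …, e, r + 1 and closing step j, whose non-adjacent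
  -- vertices differ by δd with e < δ < j; hence C_n(S) is not chordal.
  module GapCycle (d e j : ℕ) (1≤e : 1 ≤ e) (2+e≤j : 2 + e ≤ j)
    (short : ∀ δ → 1 ≤ δ → δ ≤ e → Edge (δ * d))
    (gap : ∀ δ → e < δ → δ < j → ¬ Edge (δ * d))
    (nonzero : ∀ δ → 1 ≤ δ → δ ≤ j → ¬ n ∣ δ * d)
    (long : Edge (j * d)) where

    instance
      e≢0 : NonZero e
      e≢0 = >-nonZero 1≤e

    q r : ℕ
    q = (j ∸ 2) / e
    r = (j ∸ 2) % e

    j-split : j ≡ 2 + (r + q * e)
    j-split = trans (sym (m+[n∸m]≡n (≤-trans (s≤s (s≤s z≤n)) 2+e≤j)))
                    (cong (2 +_) (m≡m%n+[m/n]*n (j ∸ 2) e))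

    1≤q : 1 ≤ q
    1≤q = m≥n⇒m/n>0 (m+n≤o⇒n≤o∸m 2 2+e≤j)

    -- cycle labels 0, 1, 1 + e, …, 1 + qe, j at positions 0, …, L = q + 2,
    -- written uniformly as v (i + 1) = min(1 + ie, j)
    v : ℕ → ℕ
    v zero = 0
    v (suc i) = (1 + i * e) ⊓ j

    L : ℕ
    L = 2 + q

    inner<j : ∀ i → i ≤ q → 1 + i * e < j
    inner<j i i≤q = subst (1 + i * e <_) (sym j-split)
      (s≤s (s≤s (≤-trans (*-monoˡ-≤ e i≤q) (m≤n+m (q * e) r))))

    v-inner : ∀ i → i ≤ q → v (suc i) ≡ 1 + i * e
    v-inner i i≤q = m≤n⇒m⊓n≡m (<⇒≤ (inner<j i i≤q))

    v-last : v L ≡ j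
    v-last = m≥n⇒m⊓n≡n (subst (_≤ 1 + (e + q * e)) (sym j-split)
                          (s≤s (+-monoˡ-≤ (q * e) (m%n<n (j ∸ 2) e))))

    v-step : ∀ i → i < L → v i < v (suc i) × v (suc i) ≤ v i + e
    v-step zero _ rewrite v-inner 0 z≤n = z<s , 1≤e
    v-step (suc i) (s≤s 1+i≤1+q) rewrite v-inner i (s≤s⁻¹ 1+i≤1+q) =
      ⊓-glb (s≤s (+-monoˡ-≤ (i * e) 1≤e)) (inner<j i (s≤s⁻¹ 1+i≤1+q)) ,
      ≤-trans (m⊓n≤m _ j) (≤-reflexive (cong suc (+-comm e (i * e))))

    v-skip : ∀ i → i ≤ q → v i + suc e ≤ v (2 + i)
    v-skip zero _ = ⊓-glb (s≤s (m≤m+n e 0)) (≤-trans (n≤1+n _) 2+e≤j)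
    v-skip (suc i) 1+i≤q rewrite v-inner i (<⇒≤ 1+i≤q) =
      subst (_≤ (1 + (2 + i) * e) ⊓ j) (sym shift)
        (⊓-glb (s≤s (+-monoˡ-≤ (e + i * e) 1≤e)) (inner<j (suc i) 1+i≤q))
      where
        shift : 1 + i * e + suc e ≡ 2 + (e + i * e)
        shift = cong suc (trans (+-suc (i * e) e) (cong suc (+-comm (i * e) e)))

    v-mono : ∀ {a b} → a ≤ b → b ≤ L → v a ≤ v b
    v-mono = increasing⇒monotone v L (λ i i<L → proj₁ (v-step i i<L))

    v-strict : ∀ {a b} → a < b → b ≤ L → v a < v b
    v-strict {a} a<b b≤L = <-≤-trans (proj₁ (v-step a (<-≤-trans a<b b≤L))) (v-mono a<b b≤L)

    v≤j : ∀ {b} → b ≤ L → v b ≤ j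
    v≤j b≤L = ≤-trans (v-mono b≤L ≤-refl) (≤-reflexive v-last)

    f : ℕ → Fin n
    f i = vertex (v i * d)

    label-difference : ∀ a b → v b * d ∸ v a * d ≡ (v b ∸ v a) * d
    label-difference a b = sym (*-distribʳ-∸ d (v b) (v a))

    f-adj : ∀ {a b} → a ≤ b → b ≤ L → Edge ((v b ∸ v a) * d) → Adj n S (f a) (f b)
    f-adj {a} {b} a≤b b≤L edge = adj-sym (f b) (f a)
      (edge⇒adj (*-monoˡ-≤ d (v-mono a≤b b≤L)) (subst Edge (sym (label-difference a b)) edge))

    adj-f : ∀ {a b} → a ≤ b → b ≤ L → Adj n S (f a) (f b) → Edge ((v b ∸ v a) * d)
    adj-f {a} {b} a≤b b≤L fa~fb = subst Edge (label-difference a b)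
      (adj⇒edge (*-monoˡ-≤ d (v-mono a≤b b≤L)) (adj-sym (f a) (f b) fa~fb))

    distinct : ∀ a b → a < b → b ≤ L → f a ≢ f b
    distinct a b a<b b≤L fa≡fb = nonzero (v b ∸ v a) (m<n⇒0<n∸m (v-strict a<b b≤L))
      (≤-trans (m∸n≤m (v b) (v a)) (v≤j b≤L))
      (subst (n ∣_) (label-difference a b)
        (vertex-≡⇒∣ (*-monoˡ-≤ d (<⇒≤ (v-strict a<b b≤L))) (sym fa≡fb)))

    path : ∀ i → i < L → Adj n S (f i) (f (suc i))
    path i i<L with v-step i i<L
    ... | v<v′ , v′≤v+e = f-adj (n≤1+n i) i<L (short _ (m<n⇒0<n∸m v<v′) (m≤n+o⇒m∸n≤o _ (v i) v′≤v+e))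

    closing : Adj n S (f L) (f 0)
    closing = edge⇒adj z≤n (subst (λ t → Edge (t * d)) (sym v-last) long)

    chordless : ¬ OrientedChord L f
    chordless (a , b , 1+a<b , b≤L , fa~fb , notClosing) =
      gap (v b ∸ v a) e<δ (δ<j notClosing) (adj-f (<⇒≤ a<b) b≤L fa~fb)
      where
        a<b : a < b
        a<b = <-trans (n<1+n a) 1+a<b
        e<δ : e < v b ∸ v a
        e<δ = m+n≤o⇒n≤o∸m (v a)
                (≤-trans (v-skip a (s≤s⁻¹ (s≤s⁻¹ (≤-trans 1+a<b b≤L)))) (v-mono 1+a<b b≤L))
        δ<j : 0 < a ⊎ b < L → v b ∸ v a < j
        δ<j (inj₁ 0<a) = <-≤-trans (∸-monoʳ-< (v-strict 0<a (≤-trans (<⇒≤ a<b) b≤L))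
                                               (v-mono (<⇒≤ a<b) b≤L)) (v≤j b≤L)
        δ<j (inj₂ b<L) = ≤-<-trans (m∸n≤m (v b) (v a)) (subst (v b <_) v-last (v-strict b<L ≤-refl))

    notChordal : ¬ Chordal n S
    notChordal chordal =
      chordless (orient L f (chordal (suc L) f (s≤s (s≤s (s≤s 1≤q)))
                  (mkCycle L f (s≤s (s≤s z≤n)) distinct path closing)))

  -- If d, 2d, …, (k-1)d are connection lengths and kd ≡ 0, then the pattern
  -- repeats with period k: every multiple of d is a connection length or ≡ 0.
  periodic : ∀ d k .{{_ : NonZero k}} → n ∣ k * d → (∀ δ → 0 < δ → δ < k → Edge (δ * d)) →
    ∀ l → Edge (l * d) ⊎ n ∣ l * d
  periodic d k n∣kd edge l = by-residue (l % k) refl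
    where
      split : l * d ≡ l % k * d + l / k * (k * d)
      split = begin
        l * d                          ≡⟨ cong (_* d) (m≡m%n+[m/n]*n l k) ⟩
        (l % k + l / k * k) * d        ≡⟨ *-distribʳ-+ d (l % k) (l / k * k) ⟩
        l % k * d + l / k * k * d      ≡⟨ cong (l % k * d +_) (*-assoc (l / k) k d) ⟩
        l % k * d + l / k * (k * d)    ∎
        where open ≡-Reasoning
      n∣period : n ∣ l / k * (k * d)
      n∣period = ∣n⇒∣m*n (l / k) n∣kd
      by-residue : ∀ r → l % k ≡ r → Edge (l * d) ⊎ n ∣ l * d
      by-residue zero l%k≡0 =
        inj₂ (subst (n ∣_) (sym (trans split (cong (λ r → r * d + l / k * (k * d)) l%k≡0))) n∣period)
      by-residue (suc r) l%k≡1+r = inj₁ (edge-mod same-residue (edge (suc r) z<s (subst (_< k) l%k≡1+r (m%n<n l k))))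
        where
          same-residue : (suc r * d) % n ≡ (l * d) % n
          same-residue = sym (trans (cong (_% n) split)
            (trans (%-remove-+ʳ (l % k * d) n∣period) (cong (λ t → t * d % n) l%k≡1+r)))

  Regular : ℕ → ℕ → Set
  Regular d δ = Edge (δ * d) × ¬ n ∣ δ * d

  regular? : ∀ d δ → Dec (Regular d δ)
  regular? d δ = edge? (δ * d) ×-dec ¬? (n ∣? δ * d)

  -- the least irregular multiple kd, 1 ≤ k ≤ n (it exists since nd ≡ 0)
  first-irregular : ∀ d → Σ ℕ λ k → 0 < k × k ≤ n × ¬ Regular d k × (∀ δ → 0 < δ → δ < k → Regular d δ)
  first-irregular d with least (λ δ → 0 <? δ ×-dec ¬? (regular? d δ)) n (>-nonZero⁻¹ n , λ r → proj₂ r (m∣m*n d))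
  ... | k , k≤n , (0<k , irregular) , before =
    k , 0<k , k≤n , irregular , λ δ 0<δ δ<k → decidable-stable (regular? d δ) (λ ¬r → before δ δ<k (0<δ , ¬r))

  -- A gap e < δ < j in the multiples of the connection length d, ending at a
  -- multiple jd that is a connection length or ≡ 0, contradicts chordality;
  -- jd ≡ 0 is impossible since then (j-1)d ≡ -d would be a connection length.
  gap-between : Chordal n S → ∀ d e j → Edge d → suc e < j →
    (∀ δ → 0 < δ → δ ≤ e → Regular d δ) → (∀ δ → e < δ → δ < j → ¬ Edge (δ * d) × ¬ n ∣ δ * d) →
    Edge (j * d) ⊎ n ∣ j * d → ⊥
  gap-between _ d zero _ edge-d 1<j _ silent _ =
    proj₁ (silent 1 z<s 1<j) (subst Edge (sym (*-identityˡ d)) edge-d)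
  gap-between chordal d e@(suc _) (suc j′) edge-d (s≤s k≤j′) regular silent hit =
    GapCycle.notChordal d e (suc j′) z<s (s≤s k≤j′) short gap nonzero long chordal
    where
      -- (j-1)d + d = jd
      j-nonzero : ¬ n ∣ suc j′ * d
      j-nonzero n∣jd = proj₁ (silent j′ k≤j′ ≤-refl) (edge-neg n∣jd edge-d)
      long : Edge (suc j′ * d)
      long = [ (λ edge → edge) , (λ n∣jd → ⊥-elim (j-nonzero n∣jd)) ]′ hit
      short : ∀ δ → 1 ≤ δ → δ ≤ e → Edge (δ * d)
      short δ 1≤δ δ≤e = proj₁ (regular δ 1≤δ δ≤e)
      gap : ∀ δ → e < δ → δ < suc j′ → ¬ Edge (δ * d)
      gap δ e<δ δ<j = proj₁ (silent δ e<δ δ<j)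
      nonzero : ∀ δ → 1 ≤ δ → δ ≤ suc j′ → ¬ n ∣ δ * d
      nonzero δ 1≤δ δ≤j with δ ≤? e | m≤n⇒m<n∨m≡n δ≤j
      ... | yes δ≤e | _ = proj₂ (regular δ 1≤δ δ≤e)
      ... | no δ≰e | inj₁ δ<j = proj₂ (silent δ (≰⇒> δ≰e) δ<j)
      ... | no _ | inj₂ refl = j-nonzero

  -- If d, …, (k-1)d are nonzero connection lengths while kd is neither ≡ 0
  -- nor a connection length, the least j > k with jd a connection length or
  -- ≡ 0 bounds a gap, contradicting chordality.
  no-gap : Chordal n S → ∀ d k → Edge d → k ≤ n → (∀ δ → 0 < δ → δ < k → Regular d δ) →
    ¬ n ∣ k * d → ¬ Edge (k * d) → ⊥
  no-gap _ d zero _ _ _ ¬n∣0 _ = ¬n∣0 (n ∣0)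
  no-gap chordal d (suc e) edge-d k≤n before ¬n∣kd ¬edge-kd
    with least (λ i → suc e <? i ×-dec (edge? (i * d) ⊎-dec (n ∣? i * d))) n
               (≤∧≢⇒< k≤n (λ { refl → ¬n∣kd (m∣m*n d) }) , inj₂ (m∣m*n d))
  ... | j , _ , (k<j , hit) , no-hit-before =
    gap-between chordal d e j edge-d k<j (λ δ 0<δ δ≤e → before δ 0<δ (s≤s δ≤e)) silent hit
    where
      silent : ∀ δ → e < δ → δ < j → ¬ Edge (δ * d) × ¬ n ∣ δ * d
      silent δ k≤δ δ<j with m≤n⇒m<n∨m≡n k≤δ
      ... | inj₂ refl = ¬edge-kd , ¬n∣kd
      ... | inj₁ k<δ = (λ edge → no-hit-before δ δ<j (k<δ , inj₁ edge))
                     , (λ n∣δd → no-hit-before δ δ<j (k<δ , inj₂ n∣δd))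

  multiples : Chordal n S → ∀ d → Edge d → ∀ l → Edge (l * d) ⊎ n ∣ l * d
  multiples chordal d edge-d with first-irregular d
  ... | k , 0<k , k≤n , irregular , before with n ∣? k * d
  ...   | yes n∣kd = periodic d k {{>-nonZero 0<k}} n∣kd (λ δ 0<δ δ<k → proj₁ (before δ 0<δ δ<k))
  ...   | no ¬n∣kd = ⊥-elim (no-gap chordal d k edge-d k≤n before ¬n∣kd (λ edge → irregular (edge , ¬n∣kd)))

same-members⇒SameGraph : ∀ n {P Q : ℕ → Set} → (∀ x → P x → Q x) → (∀ x → Q x → P x) → SameGraph n P Q
same-members⇒SameGraph n P⇒Q Q⇒P i j = P⇒Q (circDist n i j) , Q⇒P (circDist n i j)

module Forward (n : ℕ) {{n≢0 : NonZero n}} (S : ℕ → Bool) (conn : ConnSet n S) where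

  loopless : ¬ Mem S 0
  loopless 0∈S with proj₁ (conn 0 0∈S)
  ... | ()

  open Circulant n S loopless

  double≤n : ∀ {x} → Mem S x → x + x ≤ n
  double≤n {x} x∈S = ≤half⇒double≤ x n (proj₂ (conn x x∈S))

  module LeastElement (chordal : Chordal n S) (d : ℕ) (d∈S : Mem S d)
                      (d-least : ∀ x → x < d → ¬ Mem S x) where

    1≤d : 1 ≤ d
    1≤d = proj₁ (conn d d∈S)

    instance
      d≢0 : NonZero d
      d≢0 = >-nonZero 1≤d

    edge-d : Edge d
    edge-d = mem⇒edge (double≤n d∈S) d∈S

    no-edge-below : ∀ x → x < d → ¬ Edge x
    no-edge-below x x<d edge =
      d-least x x<d (edge⇒mem (≤-trans (+-mono-≤ (<⇒≤ x<d) (<⇒≤ x<d)) (double≤n d∈S)) edge)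

    -- If n = qd + r with 0 < r < d, then (q+1)d ≡ d - r, a nonzero residue below d,
    -- which by `multiples` would be a connection length.
    d∣n : d ∣ n
    d∣n with n % d in n%d≡
    ... | zero = m%n≡0⇒n∣m n d n%d≡
    ... | suc r = ⊥-elim ([ no-edge-below u u<d ∘ edge-mod ([m+n]%n≡m%n u n) ∘ subst Edge overshoot
                  , half⇒∤ 0<u u+u≤n ∘ (λ n∣ → ∣m+n∣m⇒∣n (subst (n ∣_) (trans overshoot (+-comm u n)) n∣) ∣-refl)
                  ]′ (multiples chordal d edge-d (suc (n / d))))
      where
        r<d : suc r < d
        r<d = subst (_< d) n%d≡ (m%n<n n d)
        u : ℕ
        u = d ∸ suc r
        u<d : u < d
        u<d = ∸-monoʳ-< z<s (<⇒≤ r<d)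
        0<u : 0 < u
        0<u = m<n⇒0<n∸m r<d
        u+u≤n : u + u ≤ n
        u+u≤n = ≤-trans (+-mono-≤ (<⇒≤ u<d) (<⇒≤ u<d)) (double≤n d∈S)
        overshoot : suc (n / d) * d ≡ u + n
        overshoot = sym (begin
          u + n                        ≡⟨ cong (u +_) (m≡m%n+[m/n]*n n d) ⟩
          u + (n % d + n / d * d)      ≡⟨ cong (λ t → u + (t + n / d * d)) n%d≡ ⟩
          u + (suc r + n / d * d)      ≡⟨ +-assoc u (suc r) (n / d * d) ⟨
          u + suc r + n / d * d        ≡⟨ cong (_+ n / d * d) (m∸n+n≡m (<⇒≤ r<d)) ⟩
          d + n / d * d                ∎)
          where open ≡-Reasoning

    -- A least element b of S not divisible by d cannot exist.  Its translates
    -- b + ld are all connection lengths: in the 4-cycle 0, d, b + (l+1)d, b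
    -- the diagonal d–b would have length b - d, an element of S below b and not
    -- divisible by d; so the other diagonal is an edge.  The translate ≡ b mod d
    -- that falls below d then contradicts the minimality of d.
    module Indivisible (b : ℕ) (b∈S : Mem S b) (d∤b : ¬ d ∣ b)
                       (smaller : ∀ x → x < b → Mem S x → d ∣ x) where

      d≤b : d ≤ b
      d≤b = ≮⇒≥ (λ b<d → d-least b b<d b∈S)

      edge-b : Edge b
      edge-b = mem⇒edge (double≤n b∈S) b∈S

      no-edge-b-d : ¬ Edge (b ∸ d)
      no-edge-b-d edge = d∤b (∣m∸n∣n⇒∣m d d≤b (smaller (b ∸ d) (∸-monoʳ-< 1≤d d≤b) b-d∈S) ∣-refl)
        where
          b-d∈S : Mem S (b ∸ d)
          b-d∈S = edge⇒mem (≤-trans (+-mono-≤ (m∸n≤m b d) (m∸n≤m b d)) (double≤n b∈S)) edge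

      square-step : ∀ l → Edge (b + l * d) → Edge (suc l * d) → Edge (b + suc l * d)
      square-step l edge-bl edge-l+1 with edge? (b + suc l * d)
      ... | yes edge-w = edge-w
      ... | no ¬edge-w =
        ⊥-elim ([ (λ x₀~x₂ → ¬edge-w (adj⇒edge z≤n (adj-sym (vertex 0) (vertex w) x₀~x₂)))
                , (λ x₁~x₃ → no-edge-b-d (adj⇒edge d≤b (adj-sym (vertex d) (vertex b) x₁~x₃)))
                ]′ (square-diagonal chordal (vertex 0) (vertex d) (vertex w) (vertex b)
                      x₀~x₁ x₁~x₂ x₂~x₃ x₃~x₀ x₀≢x₂ x₁≢x₃))
        where
          w : ℕ
          w = b + suc l * d
          w-d : w ∸ d ≡ b + l * d
          w-d = trans (cong (_∸ d) (+-comm-middle b d (l * d))) (m+n∸m≡n d (b + l * d))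
            where
              +-comm-middle : ∀ x y z → x + (y + z) ≡ y + (x + z)
              +-comm-middle = solve-∀
          x₀~x₁ : Adj n S (vertex 0) (vertex d)
          x₀~x₁ = adj-sym (vertex d) (vertex 0) (edge⇒adj z≤n edge-d)
          x₁~x₂ : Adj n S (vertex d) (vertex w)
          x₁~x₂ = adj-sym (vertex w) (vertex d)
                    (edge⇒adj (≤-trans d≤b (m≤m+n b _)) (subst Edge (sym w-d) edge-bl))
          x₂~x₃ : Adj n S (vertex w) (vertex b)
          x₂~x₃ = edge⇒adj (m≤m+n b _) (subst Edge (sym (m+n∸m≡n b (suc l * d))) edge-l+1)
          x₃~x₀ : Adj n S (vertex b) (vertex 0)
          x₃~x₀ = edge⇒adj z≤n edge-b
          x₀≢x₂ : vertex 0 ≢ vertex w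
          x₀≢x₂ eq = d∤b (∣m+n∣m⇒∣n (subst (d ∣_) (+-comm b (suc l * d)) (∣-trans d∣n (vertex-≡⇒∣ z≤n (sym eq))))
                                    (n∣m*n (suc l)))
          x₁≢x₃ : vertex d ≢ vertex b
          x₁≢x₃ eq = d∤b (∣m∸n∣n⇒∣m d d≤b (∣-trans d∣n (vertex-≡⇒∣ d≤b (sym eq))) ∣-refl)

      translates : ∀ l → Edge (b + l * d)
      translates zero = subst Edge (sym (+-identityʳ b)) edge-b
      translates (suc l) with multiples chordal d edge-d (suc l)
      ... | inj₁ edge-l+1 = square-step l (translates l) edge-l+1
      ... | inj₂ n∣l+1 = edge-mod (sym (%-remove-+ʳ b n∣l+1)) edge-b

      -- with n = (m′+1)d, the translate b + m′⌊b/d⌋d is ≡ b mod d (mod n)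
      impossible : ⊥
      impossible with d∣n
      ... | divides zero n≡0 = ≢-nonZero⁻¹ n n≡0
      ... | divides (suc m′) n≡ = no-edge-below (b % d) (m%n<n b d)
          (edge-mod ([m+kn]%n≡m%n (b % d) (b / d) n) (subst Edge land (translates (m′ * (b / d)))))
        where
          land : b + m′ * (b / d) * d ≡ b % d + b / d * n
          land = begin
            b + m′ * (b / d) * d                     ≡⟨ cong (_+ m′ * (b / d) * d) (m≡m%n+[m/n]*n b d) ⟩
            b % d + b / d * d + m′ * (b / d) * d     ≡⟨ regroup (b % d) (b / d) d m′ ⟩
            b % d + b / d * (suc m′ * d)             ≡⟨ cong (λ t → b % d + b / d * t) n≡ ⟨
            b % d + b / d * n                        ∎
            where
              open ≡-Reasoning
              regroup : ∀ r q d m′ → r + q * d + m′ * q * d ≡ r + q * ((1 + m′) * d)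
              regroup = solve-∀

    divisible : ∀ x → Mem S x → d ∣ x
    divisible = <-rec _ λ b smaller b∈S → decidable-stable (d ∣? b)
      (λ d∤b → Indivisible.impossible b b∈S d∤b (λ x x<b → smaller x<b))

    member⇒multiple : ∀ x → Mem S x → Multiples d (n / d) x
    member⇒multiple x x∈S with divisible x x∈S
    ... | divides l x≡ld = l , n≢0⇒n>0 l≢0 , l≤ , x≡ld
      where
        l≢0 : l ≢ 0
        l≢0 l≡0 = loopless (subst (Mem S) (trans x≡ld (cong (_* d) l≡0)) x∈S)
        l≤ : l ≤ n / d / 2
        l≤ = multiple≤half l d (n / d) (subst₂ _≤_ (cong₂ _+_ x≡ld x≡ld) (sym (m/n*n≡m d∣n)) (double≤n x∈S))

    multiple⇒member : ∀ x → Multiples d (n / d) x → Mem S x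
    multiple⇒member .(l * d) (l , 1≤l , l≤ , refl) =
      edge⇒mem ld+ld≤n ([ (λ edge → edge) , (λ n∣ld → ⊥-elim (half⇒∤ (*-mono-≤ 1≤l 1≤d) ld+ld≤n n∣ld)) ]′
                         (multiples chordal d edge-d l))
      where
        ld+ld≤n : l * d + l * d ≤ n
        ld+ld≤n = subst (l * d + l * d ≤_) (m/n*n≡m d∣n) (half⇒multiple≤ l d (n / d) l≤)

  chordal⇒multiples : Chordal n S →
    Σ ℕ λ d → Σ ℕ λ m → (1 ≤ d) × (n ≡ d * m) × SameGraph n (Mem S) (Multiples d m)
  chordal⇒multiples chordal with leastUpTo (λ x → S x Bool.≟ true) n
  ... | inj₂ (d , _ , d∈S , d-least) =
    d , n / d , 1≤d , sym (m*[n/m]≡n d∣n) , same-members⇒SameGraph n member⇒multiple multiple⇒member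
    where open LeastElement chordal d d∈S d-least
  ... | inj₁ S-empty =
    n , 1 , >-nonZero⁻¹ n , sym (*-identityʳ n) ,
    same-members⇒SameGraph n {Mem S} {Multiples n 1} (λ x x∈S → ⊥-elim (S-empty x (≤-trans (m≤m+n x x) (double≤n x∈S)) x∈S))
                             (λ { x (l , 1≤l , l≤0 , _) → ⊥-elim (<⇒≱ 1≤l l≤0) })

∣-complement : ∀ {d n c} → d ∣ n → c ≤ n → d ∣ c → d ∣ n ∸ c
∣-complement {d} d∣n c≤n d∣c = ∣m+n∣m⇒∣n (subst (d ∣_) (sym (m+[n∸m]≡n c≤n)) d∣n) d∣c

∣⇒∣min : ∀ {d n c} → d ∣ n → c ≤ n → d ∣ c → d ∣ c ⊓ (n ∸ c)
∣⇒∣min {d} {n} {c} d∣n c≤n d∣c with ⊓-sel c (n ∸ c)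
... | inj₁ min≡c = subst (d ∣_) (sym min≡c) d∣c
... | inj₂ min≡n-c = subst (d ∣_) (sym min≡n-c) (∣-complement d∣n c≤n d∣c)

∣min⇒∣ : ∀ {d n c} → d ∣ n → c ≤ n → d ∣ c ⊓ (n ∸ c) → d ∣ c
∣min⇒∣ {d} {n} {c} d∣n c≤n d∣min with ⊓-sel c (n ∸ c)
... | inj₁ min≡c = subst (d ∣_) min≡c d∣min
... | inj₂ min≡n-c = subst (d ∣_) (m∸[m∸n]≡n c≤n)
                       (∣-complement d∣n (m∸n≤m n c) (subst (d ∣_) min≡n-c d∣min))

∣∸⇒%≡ : ∀ d .{{_ : NonZero d}} {a b} → b ≤ a → d ∣ a ∸ b → a % d ≡ b % d
∣∸⇒%≡ d {a} {b} b≤a d∣a-b = trans (cong (_% d) (sym (m∸n+n≡m b≤a))) (%-remove-+ˡ b d∣a-b)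

∣∣-∣⇒%≡ : ∀ d .{{_ : NonZero d}} a b → d ∣ ∣ a - b ∣ → a % d ≡ b % d
∣∣-∣⇒%≡ d a b d∣ with ≤-total b a
... | inj₁ b≤a = ∣∸⇒%≡ d b≤a (subst (d ∣_) (m≤n⇒∣n-m∣≡n∸m b≤a) d∣)
... | inj₂ a≤b = sym (∣∸⇒%≡ d a≤b (subst (d ∣_) (m≤n⇒∣m-n∣≡n∸m a≤b) d∣))

%≡⇒∣∣-∣ : ∀ d .{{_ : NonZero d}} a b → a % d ≡ b % d → d ∣ ∣ a - b ∣
%≡⇒∣∣-∣ d a b a≡b with ≤-total b a
... | inj₁ b≤a = subst (d ∣_) (sym (m≤n⇒∣n-m∣≡n∸m b≤a)) (%-≡⇒∣∸ d a b b≤a a≡b)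
... | inj₂ a≤b = subst (d ∣_) (sym (m≤n⇒∣m-n∣≡n∸m a≤b)) (%-≡⇒∣∸ d b a a≤b (sym a≡b))

-- A graph whose adjacency is transitive on distinct vertices is chordal: in
-- any cycle the first and the third vertex are joined by a chord.
transitive⇒chordal : ∀ n S → (∀ x y z → Adj n S x y → Adj n S y z → x ≢ z → Adj n S x z) → Chordal n S
transitive⇒chordal n S transitive (suc (suc (suc (suc k)))) f _ (_ , injective , path) =
  0 , 2 , z<s , s≤s (s≤s z<s) , transitive (f 0) (f 1) (f 2) (path 0 z<s) (path 1 (s≤s z<s)) f₀≢f₂ ,
  (λ ()) , (λ ())
  where
    f₀≢f₂ : f 0 ≢ f 2
    f₀≢f₂ f₀≡f₂ with injective 0 2 z<s (s≤s (s≤s z<s)) f₀≡f₂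
    ... | ()
transitive⇒chordal n S _ 0 f () _
transitive⇒chordal n S _ 1 f (s≤s ()) _
transitive⇒chordal n S _ 2 f (s≤s (s≤s ())) _
transitive⇒chordal n S _ 3 f (s≤s (s≤s (s≤s ()))) _

-- The backward direction: in C_n({d, 2d, …, ⌊m/2⌋d}) with n = dm, distinct
-- vertices are adjacent exactly when their labels agree modulo d.
module Backward (n d m : ℕ) {{d≢0 : NonZero d}} (n≡dm : n ≡ d * m) (S : ℕ → Bool)
                (same : SameGraph n (Mem S) (Multiples d m)) where

  d∣n : d ∣ n
  d∣n = divides m (trans n≡dm (*-comm d m))

  diff<n : ∀ (i j : Fin n) → ∣ toℕ i - toℕ j ∣ < n
  diff<n i j = ≤-<-trans (∣m-n∣≤m⊔n (toℕ i) (toℕ j)) (⊔-lub (toℕ<n i) (toℕ<n j))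

  adj⇒≡ : ∀ i j → Adj n S i j → toℕ i % d ≡ toℕ j % d
  adj⇒≡ i j i~j with proj₁ (same i j) i~j
  ... | l , _ , _ , dist≡ld = ∣∣-∣⇒%≡ d (toℕ i) (toℕ j) (∣min⇒∣ d∣n (<⇒≤ (diff<n i j)) (divides l dist≡ld))

  ≡⇒adj : ∀ i j → i ≢ j → toℕ i % d ≡ toℕ j % d → Adj n S i j
  ≡⇒adj i j i≢j i≡j with ∣⇒∣min d∣n (<⇒≤ (diff<n i j)) (%≡⇒∣∣-∣ d (toℕ i) (toℕ j) i≡j)
  ... | divides l dist≡ld = proj₂ (same i j) (l , n≢0⇒n>0 l≢0 , l≤ , dist≡ld)
    where
      c : ℕ
      c = ∣ toℕ i - toℕ j ∣
      dist-positive : 0 < c ⊓ (n ∸ c)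
      dist-positive = ⊓-glb (n≢0⇒n>0 (λ c≡0 → i≢j (toℕ-injective (∣m-n∣≡0⇒m≡n c≡0))))
                            (m<n⇒0<n∸m (diff<n i j))
      l≢0 : l ≢ 0
      l≢0 l≡0 = <⇒≢ dist-positive (sym (trans dist≡ld (cong (_* d) l≡0)))
      dist-double : c ⊓ (n ∸ c) + c ⊓ (n ∸ c) ≤ n
      dist-double = ≤-trans (+-mono-≤ (m⊓n≤m c (n ∸ c)) (m⊓n≤n c (n ∸ c)))
                            (≤-reflexive (m+[n∸m]≡n (<⇒≤ (diff<n i j))))
      l≤ : l ≤ m / 2
      l≤ = multiple≤half l d m (subst₂ _≤_ (cong₂ _+_ dist≡ld dist≡ld) (trans n≡dm (*-comm d m)) dist-double)

  chordal : Chordal n S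
  chordal = transitive⇒chordal n S λ x y z x~y y~z x≢z →
    ≡⇒adj x z x≢z (trans (adj⇒≡ x y x~y) (adj⇒≡ y z y~z))

theorem2p1 : (n : ℕ) → 1 ≤ n → (S : ℕ → Bool) → ConnSet n S →
    Chordal n S ⇔
      (Σ ℕ λ d → Σ ℕ λ m → (1 ≤ d) × (n ≡ d * m) × SameGraph n (Mem S) (Multiples d m))
theorem2p1 (suc n′) _ S conn =
  mk⇔ (Forward.chordal⇒multiples (suc n′) S conn)
      (λ (d , m , 1≤d , n≡dm , same) → Backward.chordal (suc n′) d m {{>-nonZero 1≤d}} n≡dm S same)
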